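{- Let $\lambda$ be a strict partition ($\lambda_1>\lambda_2>\cdots>\lambda_n\ge0$). Then the number of gapless $\lambda$-keys is the Catalan number $C_n=\frac{1}{n+1}\binom{2n}{n}$.
   Context: Shape of $\lambda$: boxes $(j,i)$ (column $j$, row $i$), $1\le j\le\lambda_1$, $1\le i\le\zeta_j=\#\{i:\lambda_i\ge j\}$; for strict $\lambda$ the column lengths less than $n$ are exactly $1,2,\dots,n-1$. A tableau of shape $\lambda$ is a filling with values in $\{1,\dots,n\}$ strictly increasing down columns and weakly increasing along rows. A $\lambda$-key is a tableau $Y$ of shape $\lambda$ such that the set of entries of column $l$ contains the set of entries of column $j$ whenever $l\le j$. A $\lambda$-key $Y$ is gapless if for every $h\in[n-2]$: letting $b$ be the smallest value in the columns of length $h+1$ not appearing in the columns of length $h$, and $m$ the largest value in the columns of length $h$, if $b<m$ then every integer in $[b,m]$ appears in the columns of length $h+1$. -}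

module Defs where

open import Data.Nat using (ℕ; zero; suc; _+_; _*_; _∸_; _≤_; _<_; _<ᵇ_; _/_)
open import Data.Nat.Combinatorics using (_C_)
open import Data.Bool using (if_then_else_)
open import Data.Fin using (Fin; toℕ)
open import Data.Vec using (Vec; []; _∷_; lookup)
open import Data.List using (List; []; _∷_; length)
open import Data.List.Membership.Propositional using (_∈_)
open import Data.List.Relation.Unary.Unique.Propositional using (Unique)
open import Data.Empty using (⊥)
open import Data.Product using (Σ; ∃; ∃-syntax; _×_)
open import Function.Bundles using (_⇔_)
open import Relation.Binary.PropositionalEquality using (_≡_)

catalan : ℕ → ℕ
catalan n = ((2 * n) C n) / suc n

-- A partition λ with n parts λ_1,...,λ_n is a Vec ℕ n (row i is index i, 0-based).
-- Strict: λ_1 > λ_2 > ... > λ_n (≥ 0 automatically).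
StrictPartition : {n : ℕ} → Vec ℕ n → Set
StrictPartition {n} la = (i i' : Fin n) → toℕ i < toℕ i' → lookup la i' < lookup la i

-- A filling of a shape is given row by row: row i is the list of its entries
-- from left to right (column j, 0-based, is position j in each row).
Filling : ℕ → Set
Filling n = Vec (List ℕ) n

-- j-th element of a list (0-based), default 0 (only used inside the shape)
nth : List ℕ → ℕ → ℕ
nth []       _       = 0
nth (x ∷ xs) zero    = x
nth (x ∷ xs) (suc j) = nth xs j

-- entry in row i, column j (0-based column index; box (j+1, i+1) of the paper)
ent : {n : ℕ} → Filling n → Fin n → ℕ → ℕ
ent T i j = nth (lookup T i) j

colLen : {n : ℕ} → Vec ℕ n → ℕ → ℕ
colLen []         j = 0
colLen (x ∷ xs)   j = (if j <ᵇ x then 1 else 0) + colLen xs j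

IsTableau : {n : ℕ} → Vec ℕ n → Filling n → Set
IsTableau {n} la T =
    ((i : Fin n) → length (lookup T i) ≡ lookup la i)
  × ((i : Fin n) (j : ℕ) → j < lookup la i → (1 ≤ ent T i j) × (ent T i j ≤ n))
  × ((i i' : Fin n) (j : ℕ) → toℕ i < toℕ i' → j < lookup la i → j < lookup la i'
       → ent T i j < ent T i' j)
  × ((i : Fin n) (j j' : ℕ) → j ≤ j' → j' < lookup la i → ent T i j ≤ ent T i j')

InColumn : {n : ℕ} → Vec ℕ n → Filling n → ℕ → ℕ → Set
InColumn {n} la T j x = Σ (Fin n) λ i → (j < lookup la i) × (ent T i j ≡ x)

IsKey : {n : ℕ} → Vec ℕ n → Filling n → Set
IsKey la T = IsTableau la T
  × ((l j x : ℕ) → l ≤ j → InColumn la T j x → InColumn la T l x)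

InColsOfLen : {n : ℕ} → Vec ℕ n → Filling n → ℕ → ℕ → Set
InColsOfLen la T h x = Σ ℕ λ j → (colLen la j ≡ h) × InColumn la T j x

GaplessAt : {n : ℕ} → Vec ℕ n → Filling n → ℕ → Set
GaplessAt la T h =
  (b m : ℕ) →
  (InColsOfLen la T (suc h) b × (InColsOfLen la T h b → ⊥)
     × ((y : ℕ) → InColsOfLen la T (suc h) y → (InColsOfLen la T h y → ⊥) → b ≤ y)) →
  (InColsOfLen la T h m × ((y : ℕ) → InColsOfLen la T h y → y ≤ m)) →
  b < m →
  (x : ℕ) → b ≤ x → x ≤ m → InColsOfLen la T (suc h) x

IsGaplessKey : {n : ℕ} → Vec ℕ n → Filling n → Set
IsGaplessKey {n} la T = IsKey la T
  × ((h : ℕ) → 1 ≤ h → h ≤ n ∸ 2 → GaplessAt la T h)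

-- "The number of fillings satisfying P is c": there is a duplicate-free list
-- containing exactly the fillings satisfying P, of length c.
HasCount : {n : ℕ} → (Filling n → Set) → ℕ → Set
HasCount {n} P c = Σ (List (Filling n)) λ L →
  Unique L × ((T : Filling n) → (T ∈ L) ⇔ P T) × (length L ≡ c)

-- A key is determined by its column sets. For strict λ every length h < n occurs among the columns,
-- columns of equal length have equal entry sets, and the nesting of the columns makes these sets a
-- chain S₀ ⊂ S₁ ⊂ ⋯ ⊂ S_{n−1} ⊂ {1, …, n} with |S_h| = h: the prefix sets of a permutation π of
-- {1, …, n}. The gapless condition says that whenever π_{h+1} is smaller than some earlier entry, it is
-- the largest value not yet used below max(π_1, …, π_h). These are exactly the permutations produced
-- by a stack that receives 1, 2, …, n in increasing order, and the stack's possible outputs are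
-- counted by ballot numbers; the reflection principle gives C(2n, n) − C(2n, n − 1) = C_n of them.
module Submission where

open import Defs
open import Data.Nat using (ℕ)
open import Data.Vec using (Vec)

open import Data.Nat using (zero; suc; _+_; _*_; _∸_; _≤_; _<_; _>_; z≤n; s≤s; _≤?_; _<?_; _≟_; _<ᵇ_; _/_)
open import Data.Nat.Properties
open import Data.Nat.Combinatorics using (_C_; nCk≡nC[n∸k]; nC1≡n) renaming (nCk+nC[k+1]≡[n+1]C[k+1] to pascal)
open import Data.Nat.DivMod using (m*n/n≡m)
open import Data.Nat.Tactic.RingSolver using (solve-∀)
open import Data.Product using (∃-syntax; _×_; _,_; proj₁; proj₂)
open import Data.Sum using (_⊎_; inj₁; inj₂; [_,_]′; map₂; swap)
open import Data.Empty using (⊥-elim)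
open import Data.Unit using (⊤; tt)
open import Data.Bool using (true; false; T)
open import Data.Fin using (Fin; toℕ; fromℕ<) renaming (zero to fzero; suc to fsuc)
open import Data.Fin.Properties using (toℕ-fromℕ<)
open import Data.Vec using ([]; _∷_; lookup; tabulate)
open import Data.Vec.Properties using (lookup∘tabulate; tabulate∘lookup; tabulate-cong)
open import Data.List using (List; []; _∷_; [_]; _++_; _∷ʳ_; map; length; take; filter; applyUpTo)
open import Data.List.Properties
  using (length-++; length-map; ++-assoc; ++-identityʳ; length-applyUpTo; length-take; take-all; length-filter; ∷-injectiveʳ)
open import Data.List.Membership.Propositional using (_∈_; _∉_)
open import Data.List.Membership.Propositional.Properties
  using (∈-map⁺; ∈-map⁻; ∈-++⁺ˡ; ∈-++⁺ʳ; ∈-++⁻; ∈-applyUpTo⁺; ∈-applyUpTo⁻; ∈-filter⁺; ∈-filter⁻)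
open import Data.List.Membership.DecPropositional _≟_ using (_∈?_)
open import Data.List.Membership.Propositional.Properties.WithK using (unique∧set⇒bag)
open import Data.List.Relation.Unary.Any using (here; there)
open import Data.List.Relation.Unary.All as All using (All; []; _∷_)
open import Data.List.Relation.Unary.All.Properties using (¬Any⇒All¬) renaming (map⁺ to All-map⁺)
open import Data.List.Relation.Unary.AllPairs as AllPairs using (AllPairs; []; _∷_)
import Data.List.Relation.Unary.AllPairs.Properties as AllPairs
open import Data.List.Relation.Unary.Unique.Propositional using (Unique)
import Data.List.Relation.Unary.Unique.Propositional.Properties as Unique
open import Data.List.Relation.Unary.Sorted.TotalOrder.Properties using (↗↭↗⇒≋; AllPairs⇒Sorted)
open import Data.List.Relation.Unary.Sorted.TotalOrder using (Sorted)
open import Data.List.Relation.Binary.Subset.Propositional using (_⊆_)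
open import Data.List.Relation.Binary.Disjoint.Propositional using (Disjoint)
open import Data.List.Relation.Binary.Permutation.Propositional using (↭⇒↭ₛ′)
open import Data.List.Relation.Binary.Permutation.Propositional.Properties using (↭-length)
open import Data.List.Relation.Binary.BagAndSetEquality using (∼bag⇒↭)
open import Data.List.Relation.Binary.Equality.Propositional using (≋⇒≡)
open import Data.List.Extrema.Nat using (max; xs≤max; argmax-sel)
open import Function using (_∘_; mk⇔)
open import Relation.Nullary using (¬_; yes; no; contradiction)
open import Relation.Binary.PropositionalEquality hiding ([_])

private variable
  a h i j k n r t u x y M : ℕ
  xs ys pre π ρ U : List ℕ

-- Finite sets of naturals as duplicate-free lists

infix 4 _≐_
_≐_ : List ℕ → List ℕ → Set
xs ≐ ys = xs ⊆ ys × ys ⊆ xs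

length-≐ : Unique xs → Unique ys → xs ≐ ys → length xs ≡ length ys
length-≐ xs! ys! (xs⊆ys , ys⊆xs) =
  ↭-length (∼bag⇒↭ (unique∧set⇒bag xs! ys! (mk⇔ xs⊆ys ys⊆xs)))

length-⊆ : Unique xs → Unique ys → xs ⊆ ys → length xs ≤ length ys
length-⊆ {xs} {ys} xs! ys! xs⊆ys = begin
  length xs                   ≡⟨ length-≐ xs! (Unique.filter⁺ (_∈? xs) ys!) (toFilter , fromFilter) ⟩
  length (filter (_∈? xs) ys) ≤⟨ length-filter (_∈? xs) ys ⟩
  length ys                   ∎
  where
  open ≤-Reasoning
  toFilter : xs ⊆ filter (_∈? xs) ys
  toFilter x∈xs = ∈-filter⁺ (_∈? xs) (xs⊆ys x∈xs) x∈xs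
  fromFilter : filter (_∈? xs) ys ⊆ xs
  fromFilter = proj₂ ∘ ∈-filter⁻ (_∈? xs) {xs = ys}

∉⇒Unique-∷ : x ∉ xs → Unique xs → Unique (x ∷ xs)
∉⇒Unique-∷ {xs = xs} x∉xs xs! = ¬Any⇒All¬ xs x∉xs ∷ xs!

⊆-length⇒⊇ : Unique xs → Unique ys → xs ⊆ ys → length ys ≤ length xs → ys ⊆ xs
⊆-length⇒⊇ {xs} {ys} xs! ys! xs⊆ys ys≤xs {y} y∈ys with y ∈? xs
... | yes y∈xs = y∈xs
... | no y∉xs = contradiction (≤-trans (length-⊆ (∉⇒Unique-∷ y∉xs xs!) ys! y∷xs⊆ys) ys≤xs) 1+n≰n
  where
  y∷xs⊆ys : y ∷ xs ⊆ ys
  y∷xs⊆ys (here refl) = y∈ys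
  y∷xs⊆ys (there z∈xs) = xs⊆ys z∈xs

⊆-or-new : ∀ xs ys → xs ⊆ ys ⊎ ∃[ x ] x ∈ xs × x ∉ ys
⊆-or-new [] ys = inj₁ λ ()
⊆-or-new (x ∷ xs) ys with x ∈? ys | ⊆-or-new xs ys
... | no x∉ys | _ = inj₂ (x , here refl , x∉ys)
... | yes _ | inj₂ (z , z∈xs , z∉ys) = inj₂ (z , there z∈xs , z∉ys)
... | yes x∈ys | inj₁ xs⊆ys = inj₁ λ { (here refl) → x∈ys ; (there z∈xs) → xs⊆ys z∈xs }

new-element : Unique xs → Unique ys → length ys < length xs → ∃[ x ] x ∈ xs × x ∉ ys
new-element {xs} {ys} xs! ys! ys<xs with ⊆-or-new xs ys
... | inj₂ new = new
... | inj₁ xs⊆ys = contradiction (length-⊆ xs! ys! xs⊆ys) (<⇒≱ ys<xs)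

strictlyIncreasing⇒Unique : AllPairs _<_ xs → Unique xs
strictlyIncreasing⇒Unique = AllPairs.map <⇒≢

strictlyIncreasing-≐ : AllPairs _<_ xs → AllPairs _<_ ys → xs ≐ ys → xs ≡ ys
strictlyIncreasing-≐ xs< ys< (xs⊆ys , ys⊆xs) =
  ≋⇒≡ (↗↭↗⇒≋ ≤-totalOrder (sorted xs<) (sorted ys<) (↭⇒↭ₛ′ isEquivalence
    (∼bag⇒↭ (unique∧set⇒bag (strictlyIncreasing⇒Unique xs<) (strictlyIncreasing⇒Unique ys<) (mk⇔ xs⊆ys ys⊆xs)))))
  where
  sorted : ∀ {zs} → AllPairs _<_ zs → Sorted ≤-totalOrder zs
  sorted zs< = AllPairs⇒Sorted ≤-totalOrder (AllPairs.map <⇒≤ zs<)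

Unique-map⁺ : ∀ {A B : Set} {f : A → B} {as : List A} →
  (∀ {a b} → a ∈ as → b ∈ as → f a ≡ f b → a ≡ b) → Unique as → Unique (map f as)
Unique-map⁺ inj [] = []
Unique-map⁺ inj (a≢as ∷ as!) =
  All-map⁺ (All.tabulate λ b∈as fa≡fb → All.lookup a≢as b∈as (inj (here refl) (there b∈as) fa≡fb))
  ∷ Unique-map⁺ (λ a∈ b∈ → inj (there a∈) (there b∈)) as!

length≡0⇒∉ : length xs ≡ 0 → x ∉ xs
length≡0⇒∉ {[]} _ ()

length-∷ʳ : ∀ xs → length (xs ∷ʳ a) ≡ suc (length xs)
length-∷ʳ xs = trans (length-++ xs) (+-comm (length xs) 1)

max-∈ : x ∈ xs → max x xs ∈ xs
max-∈ {x} {xs} x∈xs with argmax-sel (λ z → z) x xs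
... | inj₁ max≡x = subst (_∈ xs) (sym max≡x) x∈xs
... | inj₂ max∈xs = max∈xs

head-least : AllPairs _<_ (y ∷ ys) → x ∈ y ∷ ys → y ≤ x
head-least _ (here refl) = ≤-refl
head-least (y<ys ∷ _) (there x∈ys) = <⇒≤ (All.lookup y<ys x∈ys)

length-map-++ : ∀ {A B : Set} (f : A → B) (as : List A) bs → length (map f as ++ bs) ≡ length as + length bs
length-map-++ f as bs = trans (length-++ (map f as)) (cong (_+ length bs) (length-map f as))

∈-∷ʳ⁻ : x ∈ xs ∷ʳ a → x ∈ xs ⊎ x ≡ a
∈-∷ʳ⁻ {xs = xs} x∈ with ∈-++⁻ xs x∈
... | inj₁ x∈xs = inj₁ x∈xs
... | inj₂ (here x≡a) = inj₂ x≡a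

∈-∷ʳ : a ∈ xs ∷ʳ a
∈-∷ʳ {xs = xs} = ∈-++⁺ʳ xs (here refl)

Unique-∷ʳ : a ∉ xs → Unique xs → Unique (xs ∷ʳ a)
Unique-∷ʳ a∉xs xs! = Unique.++⁺ xs! ([] ∷ []) λ { (a∈xs , here refl) → a∉xs a∈xs }

-- Permutations, prefixes and positions

range : ℕ → List ℕ
range n = applyUpTo suc n

∈-range⁺ : 1 ≤ x → x ≤ n → x ∈ range n
∈-range⁺ {suc x} _ x<n = ∈-applyUpTo⁺ suc x<n

∈-range⁻ : x ∈ range n → 1 ≤ x × x ≤ n
∈-range⁻ x∈ with ∈-applyUpTo⁻ suc x∈
... | _ , i<n , refl = s≤s z≤n , i<n

range-increasing : AllPairs _<_ (range n)
range-increasing {n} = AllPairs.applyUpTo⁺₁ suc n λ i<j _ → s≤s i<j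

range-unique : Unique (range n)
range-unique = strictlyIncreasing⇒Unique range-increasing

∈-range-suc : x ∈ range (suc M) → x ∈ range M ⊎ x ≡ suc M
∈-range-suc x∈ with ∈-range⁻ x∈
... | 1≤x , x≤1+M with m≤n⇒m<n∨m≡n x≤1+M
...   | inj₁ (s≤s x≤M) = inj₁ (∈-range⁺ 1≤x x≤M)
...   | inj₂ x≡1+M = inj₂ x≡1+M

range-⊆-suc : range M ⊆ range (suc M)
range-⊆-suc x∈ with ∈-range⁻ x∈
... | 1≤x , x≤M = ∈-range⁺ 1≤x (m≤n⇒m≤1+n x≤M)

fills-range : Unique xs → length xs ≡ n → xs ⊆ range n → range n ⊆ xs
fills-range {n = n} xs! refl xs⊆range =
  ⊆-length⇒⊇ xs! range-unique xs⊆range (≤-reflexive (length-applyUpTo suc n))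

record IsPermutation (n : ℕ) (π : List ℕ) : Set where
  field
    unique : Unique π
    length≡ : length π ≡ n
    ⊆range : π ⊆ range n
open IsPermutation

∈-take⁻ : ∀ h → x ∈ take h xs → x ∈ xs
∈-take⁻ {xs = _ ∷ _} (suc h) (here refl) = here refl
∈-take⁻ {xs = _ ∷ _} (suc h) (there x∈) = there (∈-take⁻ h x∈)

take-mono : h ≤ k → take h xs ⊆ take k xs
take-mono {xs = _ ∷ _} (s≤s h≤k) (here refl) = here refl
take-mono {xs = _ ∷ _} (s≤s h≤k) (there x∈) = there (take-mono h≤k x∈)

take-length-++ : ∀ (xs ys : List ℕ) → take (length xs) (xs ++ ys) ≡ xs
take-length-++ [] ys = refl
take-length-++ (x ∷ xs) ys = cong (x ∷_) (take-length-++ xs ys)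

take-suc-nth : h < length xs → take (suc h) xs ≡ take h xs ∷ʳ nth xs h
take-suc-nth {zero} {_ ∷ _} _ = refl
take-suc-nth {suc h} {x ∷ xs} (s≤s h<) = cong (x ∷_) (take-suc-nth h<)

prefix⊆⇒≡ : Unique xs → length xs ≡ length ys → (∀ h → take h xs ⊆ take h ys) → xs ≡ ys
prefix⊆⇒≡ {[]} {[]} _ _ _ = refl
prefix⊆⇒≡ {x ∷ xs} {y ∷ ys} (x≢xs ∷ xs!) |xs|≡|ys| prefix⊆ with prefix⊆ 1 (here refl)
... | here refl = cong (x ∷_) (prefix⊆⇒≡ xs! (suc-injective |xs|≡|ys|) tail⊆)
  where
  tail⊆ : ∀ h → take h xs ⊆ take h ys
  tail⊆ h z∈ with prefix⊆ (suc h) (there z∈)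
  ... | here refl = contradiction refl (All.lookup x≢xs (∈-take⁻ h z∈))
  ... | there z∈′ = z∈′

nth-∈ : h < length xs → nth xs h ∈ xs
nth-∈ {zero} {_ ∷ _} _ = here refl
nth-∈ {suc h} {_ ∷ _} (s≤s h<) = there (nth-∈ h<)

∈⇒nth : x ∈ xs → ∃[ h ] h < length xs × nth xs h ≡ x
∈⇒nth (here refl) = zero , s≤s z≤n , refl
∈⇒nth (there x∈) with ∈⇒nth x∈
... | h , h< , refl = suc h , s≤s h< , refl

nth∉take : Unique xs → h < length xs → nth xs h ∉ take h xs
nth∉take {x ∷ xs} {suc h} (x≢xs ∷ _) (s≤s h<) (here x≡) = All.lookup x≢xs (nth-∈ h<) (sym x≡)
nth∉take {x ∷ xs} {suc h} (_ ∷ xs!) (s≤s h<) (there x∈) = nth∉take xs! h< x∈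

nth-applyUpTo : ∀ (f : ℕ → ℕ) → j < k → nth (applyUpTo f k) j ≡ f j
nth-applyUpTo {zero} {suc k} f _ = refl
nth-applyUpTo {suc j} {suc k} f (s≤s j<k) = nth-applyUpTo (f ∘ suc) j<k

nth-ext : length xs ≡ length ys → (∀ {j} → j < length xs → nth xs j ≡ nth ys j) → xs ≡ ys
nth-ext {[]} {[]} _ _ = refl
nth-ext {x ∷ xs} {y ∷ ys} |xs|≡|ys| nth≡ =
  cong₂ _∷_ (nth≡ (s≤s z≤n)) (nth-ext (suc-injective |xs|≡|ys|) (nth≡ ∘ s≤s))

nth-increasing : AllPairs _<_ xs → i < j → j < length xs → nth xs i < nth xs j
nth-increasing {_ ∷ xs} {zero} {suc j} (x<xs ∷ _) _ (s≤s j<) = All.lookup x<xs (nth-∈ j<)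
nth-increasing {_ ∷ _} {suc i} {suc j} (_ ∷ xs<) (s≤s i<j) (s≤s j<) = nth-increasing xs< i<j j<

nth-⊆ : AllPairs _<_ xs → AllPairs _<_ ys → xs ⊆ ys → i < length xs → nth ys i ≤ nth xs i
nth-⊆ {_ ∷ _} {[]} _ _ xs⊆ys _ with xs⊆ys (here refl)
... | ()
nth-⊆ {_ ∷ _} {_ ∷ _} {zero} _ ys< xs⊆ys _ = head-least ys< (xs⊆ys (here refl))
nth-⊆ {x ∷ xs} {y ∷ ys} {suc i} (x<xs ∷ xs<) (y<ys ∷ ys<) xs⊆ys (s≤s i<) =
  nth-⊆ xs< ys< tail⊆ i<
  where
  tail⊆ : xs ⊆ ys
  tail⊆ z∈xs with xs⊆ys (there z∈xs)
  ... | there z∈ys = z∈ys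
  ... | here refl = contradiction (All.lookup x<xs z∈xs) (≤⇒≯ (head-least (y<ys ∷ ys<) (xs⊆ys (here refl))))

module _ (S : ℕ → List ℕ) (n : ℕ) (S-unique : ∀ {h} → h ≤ n → Unique (S h))
         (S-length : ∀ {h} → h ≤ n → length (S h) ≡ h) (S-nested : ∀ {h} → h < n → S h ⊆ S (suc h)) where

  private
    next-prefix : ∀ {pre} → suc (length pre) ≤ n → Unique pre → pre ≐ S (length pre) →
      ∃[ a ] a ∉ pre × pre ∷ʳ a ≐ S (suc (length pre))
    next-prefix {pre} k+1≤n pre! pre≐S with new-element (S-unique k+1≤n) pre! (≤-reflexive (sym (S-length k+1≤n)))
    ... | a , a∈S , a∉pre =
      a , a∉pre , pre∷ʳa⊆S ,
      ⊆-length⇒⊇ (Unique-∷ʳ a∉pre pre!) (S-unique k+1≤n) pre∷ʳa⊆S (≤-reflexive (trans (S-length k+1≤n) (sym (length-∷ʳ pre))))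
      where
      pre∷ʳa⊆S : pre ∷ʳ a ⊆ S (suc (length pre))
      pre∷ʳa⊆S x∈ with ∈-∷ʳ⁻ x∈
      ... | inj₁ x∈pre = S-nested k+1≤n (proj₁ pre≐S x∈pre)
      ... | inj₂ refl = a∈S

    extend : ∀ d pre → length pre + d ≡ n → Unique pre → pre ≐ S (length pre) →
      ∃[ rest ] Unique (pre ++ rest) × length (pre ++ rest) ≡ n ×
                (∀ {h} → length pre ≤ h → h ≤ n → take h (pre ++ rest) ≐ S h)
    extend zero pre |pre|+0≡n pre! pre≐S =
      [] , subst Unique (sym (++-identityʳ pre)) pre! , trans (cong length (++-identityʳ pre)) |pre|≡n , prefixes
      where
      |pre|≡n : length pre ≡ n
      |pre|≡n = trans (sym (+-identityʳ _)) |pre|+0≡n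
      prefixes : ∀ {h} → length pre ≤ h → h ≤ n → take h (pre ++ []) ≐ S h
      prefixes {h} |pre|≤h h≤n with ≤-antisym |pre|≤h (≤-trans h≤n (≤-reflexive (sym |pre|≡n)))
      ... | refl = subst (_≐ S h) (sym (take-length-++ pre [])) pre≐S
    extend (suc d) pre |pre|+1+d≡n pre! pre≐S with next-prefix k+1≤n pre! pre≐S
      where
      k+1≤n : suc (length pre) ≤ n
      k+1≤n = ≤-trans (m≤m+n _ d) (≤-reflexive (trans (sym (+-suc _ d)) |pre|+1+d≡n))
    ... | a , a∉pre , pre∷ʳa≐S
      with extend d (pre ∷ʳ a) (trans (cong (_+ d) (length-∷ʳ pre)) (trans (sym (+-suc _ d)) |pre|+1+d≡n))
                  (Unique-∷ʳ a∉pre pre!) (subst (λ k → pre ∷ʳ a ≐ S k) (sym (length-∷ʳ pre)) pre∷ʳa≐S)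
    ... | rest , π! , |π| , prefixes = a ∷ rest , subst Unique π≡ π! , trans (cong length (sym π≡)) |π| , prefixes′
      where
      π≡ : (pre ∷ʳ a) ++ rest ≡ pre ++ a ∷ rest
      π≡ = ++-assoc pre [ a ] rest
      prefixes′ : ∀ {h} → length pre ≤ h → h ≤ n → take h (pre ++ a ∷ rest) ≐ S h
      prefixes′ {h} |pre|≤h h≤n with m≤n⇒m<n∨m≡n |pre|≤h
      ... | inj₁ |pre|<h =
        subst (λ π → take h π ≐ S h) π≡ (prefixes (≤-trans (≤-reflexive (length-∷ʳ pre)) |pre|<h) h≤n)
      ... | inj₂ refl = subst (_≐ S h) (sym (take-length-++ pre (a ∷ rest))) pre≐S

  chain⇒permutation : ∃[ π ] Unique π × length π ≡ n × (∀ {h} → h ≤ n → take h π ≐ S h)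
  chain⇒permutation with extend n [] refl [] ((λ ()) , λ x∈ → ⊥-elim (length≡0⇒∉ (S-length z≤n) x∈))
  ... | π , π! , |π| , prefixes = π , π! , |π| , prefixes z≤n

-- Ballot numbers

-- The number of ways a stack can finish when r values are still to come and h values are stacked.
ballot : ℕ → ℕ → ℕ
ballot zero h = 1
ballot (suc r) zero = ballot r 1
ballot (suc r) (suc h) = ballot (suc r) h + ballot r (suc (suc h))

-- What the reflection principle subtracts: ballot r h = (2r+h) C r − (2r+h) C (r−1).
ballotDefect : ℕ → ℕ → ℕ
ballotDefect zero h = 0
ballotDefect (suc r) h = suc (suc (r + r + h)) C r

absorption : ∀ m k → suc k * (suc m C suc k) ≡ suc m * (m C k)
absorption zero zero = refl
absorption zero (suc k) = *-zeroʳ (suc (suc k))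
absorption (suc m) zero = begin
  1 * (suc (suc m) C 1) ≡⟨ *-identityˡ _ ⟩
  suc (suc m) C 1       ≡⟨ nC1≡n (suc (suc m)) ⟩
  suc (suc m)           ≡⟨ cong suc (*-identityʳ (suc m)) ⟨
  suc (suc m) * 1       ∎
  where open ≡-Reasoning
absorption (suc m) (suc k) = begin
  suc (suc k) * (suc (suc m) C suc (suc k))
    ≡⟨ cong (suc (suc k) *_) (pascal (suc m) (suc k)) ⟨
  suc (suc k) * (X + suc m C suc (suc k))
    ≡⟨ *-distribˡ-+ (suc (suc k)) X _ ⟩
  suc (suc k) * X + suc (suc k) * (suc m C suc (suc k))
    ≡⟨ cong (suc (suc k) * X +_) (absorption m (suc k)) ⟩
  suc (suc k) * X + suc m * (m C suc k)
    ≡⟨ regroup X (m C k) (m C suc k) k m (absorption m k) ⟩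
  X + suc m * (m C k + m C suc k)
    ≡⟨ cong (λ z → X + suc m * z) (pascal m k) ⟩
  X + suc m * X
    ≡⟨⟩
  suc (suc m) * X ∎
  where
  open ≡-Reasoning
  X : ℕ
  X = suc m C suc k
  regroup : ∀ X a b k m → suc k * X ≡ suc m * a → suc (suc k) * X + suc m * b ≡ X + suc m * (a + b)
  regroup X a b k m eq = begin
    suc (suc k) * X + suc m * b   ≡⟨ cong (_+ suc m * b) (cong (X +_) eq) ⟩
    X + suc m * a + suc m * b     ≡⟨ +-assoc X _ _ ⟩
    X + (suc m * a + suc m * b)   ≡⟨ cong (X +_) (*-distribˡ-+ (suc m) a b) ⟨
    X + suc m * (a + b)           ∎

C-middle : ∀ r → suc (r + r) C suc r ≡ suc (r + r) C r
C-middle r = trans (nCk≡nC[n∸k] (s≤s (m≤m+n r r))) (cong (suc (r + r) C_) (m+n∸m≡n r r))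

ballotDefect-one : ∀ r → suc (suc (r + r)) C r ≡ ballotDefect r 1 + suc (r + r) C r
ballotDefect-one zero = refl
ballotDefect-one (suc r) = begin
  suc (suc (suc r + suc r)) C suc r                      ≡⟨ pascal (suc (suc r + suc r)) r ⟨
  suc (suc r + suc r) C r + suc (suc r + suc r) C suc r  ≡⟨ cong (λ z → z C r + suc (suc r + suc r) C suc r) (e r) ⟩
  ballotDefect (suc r) 1 + suc (suc r + suc r) C suc r   ∎
  where
  open ≡-Reasoning
  e : ∀ r → suc (suc r + suc r) ≡ suc (suc (r + r + 1))
  e = solve-∀

ballotDefect-suc : ∀ r h → ballotDefect (suc r) (suc h) ≡ ballotDefect (suc r) h + ballotDefect r (suc (suc h))
ballotDefect-suc zero h = sym (+-identityʳ 1)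
ballotDefect-suc (suc r) h = begin
  suc (suc (suc r + suc r + suc h)) C suc r   ≡⟨ cong (λ z → z C suc r) (e₁ r h) ⟩
  suc N C suc r                               ≡⟨ pascal N r ⟨
  N C r + N C suc r                           ≡⟨ +-comm (N C r) _ ⟩
  N C suc r + N C r                           ≡⟨ cong (λ z → z C suc r + N C r) (e₂ r h) ⟩
  ballotDefect (suc (suc r)) h + ballotDefect (suc r) (suc (suc h)) ∎
  where
  open ≡-Reasoning
  N : ℕ
  N = suc (suc (r + r + suc (suc h)))
  e₁ : ∀ r h → suc (suc (suc r + suc r + suc h)) ≡ suc (suc (suc (r + r + suc (suc h))))
  e₁ = solve-∀
  e₂ : ∀ r h → suc (suc (r + r + suc (suc h))) ≡ suc (suc (suc r + suc r + h))
  e₂ = solve-∀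

ballot+defect : ∀ r h → ballot r h + ballotDefect r h ≡ (r + r + h) C r
ballot+defect zero h = refl
ballot+defect (suc r) zero = begin
  ballot r 1 + suc (suc (r + r + 0)) C r    ≡⟨ cong (λ z → ballot r 1 + suc (suc z) C r) (+-identityʳ (r + r)) ⟩
  ballot r 1 + suc (suc (r + r)) C r        ≡⟨ cong (ballot r 1 +_) (ballotDefect-one r) ⟩
  ballot r 1 + (ballotDefect r 1 + D C r)   ≡⟨ +-assoc (ballot r 1) _ _ ⟨
  (ballot r 1 + ballotDefect r 1) + D C r   ≡⟨ cong (_+ D C r) (ballot+defect r 1) ⟩
  (r + r + 1) C r + D C r                   ≡⟨ cong (λ z → z C r + D C r) (+-comm (r + r) 1) ⟩
  D C r + D C r                             ≡⟨ cong (D C r +_) (C-middle r) ⟨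
  D C r + D C suc r                         ≡⟨ pascal D r ⟩
  suc D C suc r                             ≡⟨ cong (_C suc r) (e r) ⟩
  (suc r + suc r + 0) C suc r               ∎
  where
  open ≡-Reasoning
  D : ℕ
  D = suc (r + r)
  e : ∀ r → suc (suc (r + r)) ≡ suc r + suc r + 0
  e = solve-∀
ballot+defect (suc r) (suc h) = begin
  ballot (suc r) h + ballot r (suc (suc h)) + ballotDefect (suc r) (suc h)
    ≡⟨ cong (ballot (suc r) h + ballot r (suc (suc h)) +_) (ballotDefect-suc r h) ⟩
  ballot (suc r) h + ballot r (suc (suc h)) + (ballotDefect (suc r) h + ballotDefect r (suc (suc h)))
    ≡⟨ +-cross (ballot (suc r) h) _ _ _ ⟩
  (ballot (suc r) h + ballotDefect (suc r) h) + (ballot r (suc (suc h)) + ballotDefect r (suc (suc h)))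
    ≡⟨ cong₂ _+_ (ballot+defect (suc r) h) (ballot+defect r (suc (suc h))) ⟩
  N C suc r + (r + r + suc (suc h)) C r   ≡⟨ cong (λ z → N C suc r + z C r) (e₁ r h) ⟩
  N C suc r + N C r                       ≡⟨ +-comm (N C suc r) _ ⟩
  N C r + N C suc r                       ≡⟨ pascal N r ⟩
  suc N C suc r                           ≡⟨ cong (_C suc r) (e₂ r h) ⟩
  (suc r + suc r + suc h) C suc r         ∎
  where
  open ≡-Reasoning
  N : ℕ
  N = suc r + suc r + h
  +-cross : ∀ p q s t → p + q + (s + t) ≡ (p + s) + (q + t)
  +-cross = solve-∀
  e₁ : ∀ r h → r + r + suc (suc h) ≡ suc r + suc r + h
  e₁ = solve-∀
  e₂ : ∀ r h → suc (suc r + suc r + h) ≡ suc r + suc r + suc h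
  e₂ = solve-∀

-- (n + 1) C(2n, n − 1) = n C(2n, n): absorption applied to C(2n, n + 1) and to C(2n − 1, n).
suc-*-ballotDefect : ∀ n → suc n * ballotDefect n 0 ≡ n * ((n + n + 0) C n)
suc-*-ballotDefect zero = refl
suc-*-ballotDefect (suc p) = begin
  suc (suc p) * (suc (suc (p + p + 0)) C p)
    ≡⟨ cong (λ z → suc (suc p) * (suc (suc z) C p)) (+-identityʳ (p + p)) ⟩
  suc (suc p) * (Z C p)
    ≡⟨ cong (suc (suc p) *_) Z-symmetric ⟩
  suc (suc p) * (Z C suc (suc p))
    ≡⟨ absorption (suc (p + p)) (suc p) ⟩
  Z * (suc (p + p) C suc p)
    ≡⟨ cong (Z *_) (C-middle p) ⟩
  Z * (suc (p + p) C p)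
    ≡⟨ absorption (suc (p + p)) p ⟨
  suc p * (Z C suc p)
    ≡⟨ cong (λ z → suc p * (z C suc p)) (e p) ⟩
  suc p * ((suc p + suc p + 0) C suc p) ∎
  where
  open ≡-Reasoning
  Z : ℕ
  Z = suc (suc (p + p))
  e : ∀ p → suc (suc (p + p)) ≡ suc p + suc p + 0
  e = solve-∀
  Z-symmetric : Z C p ≡ Z C suc (suc p)
  Z-symmetric = sym (trans (nCk≡nC[n∸k] (s≤s (s≤s (m≤m+n p p)))) (cong (Z C_) (m+n∸m≡n p p)))

catalan≡ballot : ∀ n → catalan n ≡ ballot n 0
catalan≡ballot n = begin
  ((2 * n) C n) / suc n          ≡⟨ cong (λ z → (z C n) / suc n) (e n) ⟩
  ((n + n + 0) C n) / suc n      ≡⟨ cong (_/ suc n) suc-*-ballot ⟨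
  (ballot n 0 * suc n) / suc n   ≡⟨ m*n/n≡m (ballot n 0) (suc n) ⟩
  ballot n 0                     ∎
  where
  open ≡-Reasoning
  X : ℕ
  X = (n + n + 0) C n
  e : ∀ n → 2 * n ≡ n + n + 0
  e = solve-∀
  suc-*-ballot : ballot n 0 * suc n ≡ X
  suc-*-ballot = +-cancelʳ-≡ (n * X) _ X (begin
    ballot n 0 * suc n + n * X                  ≡⟨ cong₂ _+_ (*-comm (ballot n 0) (suc n)) (sym (suc-*-ballotDefect n)) ⟩
    suc n * ballot n 0 + suc n * ballotDefect n 0 ≡⟨ *-distribˡ-+ (suc n) (ballot n 0) _ ⟨
    suc n * (ballot n 0 + ballotDefect n 0)     ≡⟨ cong (suc n *_) (ballot+defect n 0) ⟩
    X + n * X                                   ∎)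

-- Stack permutations

-- Outputs of a stack fed with the values M + 1, …, M + r in increasing order while it holds U (top first):
-- each output value is either popped or, when it exceeds M, received and passed on directly, the values
-- skipped on the way being pushed.
mutual
  stackPerms : ℕ → ℕ → List ℕ → List (List ℕ)
  stackPerms zero    M []      = [ [] ]
  stackPerms zero    M (u ∷ U) = map (u ∷_) (stackPerms zero M U)
  stackPerms (suc r) M []      = jumpPerms (suc r) M []
  stackPerms (suc r) M (u ∷ U) = map (u ∷_) (stackPerms (suc r) M U) ++ jumpPerms (suc r) M (u ∷ U)

  jumpPerms : ℕ → ℕ → List ℕ → List (List ℕ)
  jumpPerms zero    M U = []
  jumpPerms (suc r) M U = map (suc M ∷_) (stackPerms r (suc M) U) ++ jumpPerms r (suc M) (suc M ∷ U)

mutual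
  length-stackPerms : ∀ r M U → length (stackPerms r M U) ≡ ballot r (length U)
  length-stackPerms zero M [] = refl
  length-stackPerms zero M (u ∷ U) = trans (length-map (u ∷_) (stackPerms zero M U)) (length-stackPerms zero M U)
  length-stackPerms (suc r) M [] = length-jumpPerms r M []
  length-stackPerms (suc r) M (u ∷ U) = trans (length-map-++ (u ∷_) (stackPerms (suc r) M U) _)
    (cong₂ _+_ (length-stackPerms (suc r) M U) (length-jumpPerms r M (u ∷ U)))

  length-jumpPerms : ∀ r M U → length (jumpPerms (suc r) M U) ≡ ballot r (suc (length U))
  length-jumpPerms zero M U = trans (length-map-++ (suc M ∷_) (stackPerms zero (suc M) U) [])
    (trans (+-identityʳ _) (length-stackPerms zero (suc M) U))
  length-jumpPerms (suc r) M U = trans (length-map-++ (suc M ∷_) (stackPerms (suc r) (suc M) U) _)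
    (cong₂ _+_ (length-stackPerms (suc r) (suc M) U) (length-jumpPerms r (suc M) (suc M ∷ U)))

jumpPerms-head : ∀ r → a ∷ ρ ∈ jumpPerms r M U → M < a
jumpPerms-head {M = M} {U = U} (suc r) p with ∈-++⁻ (map (suc M ∷_) (stackPerms r (suc M) U)) p
... | inj₁ q with ∈-map⁻ (suc M ∷_) q
...   | _ , _ , refl = ≤-refl
jumpPerms-head (suc r) p | inj₂ q = <-trans (n<1+n _) (jumpPerms-head r q)

pop-jump-disjoint : ∀ (L : List (List ℕ)) r → u ≤ M → Disjoint (map (u ∷_) L) (jumpPerms r M U)
pop-jump-disjoint L r u≤M (p , q) with ∈-map⁻ _ p
... | _ , _ , refl = <⇒≱ (jumpPerms-head r q) u≤M

mutual
  stackPerms-unique : ∀ r M U → All (_≤ M) U → Unique (stackPerms r M U)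
  stackPerms-unique zero M [] _ = [] ∷ []
  stackPerms-unique zero M (u ∷ U) (_ ∷ U≤M) = Unique.map⁺ ∷-injectiveʳ (stackPerms-unique zero M U U≤M)
  stackPerms-unique (suc r) M [] U≤M = jumpPerms-unique (suc r) M [] U≤M
  stackPerms-unique (suc r) M (u ∷ U) (u≤M ∷ U≤M) = Unique.++⁺
    (Unique.map⁺ ∷-injectiveʳ (stackPerms-unique (suc r) M U U≤M))
    (jumpPerms-unique (suc r) M (u ∷ U) (u≤M ∷ U≤M))
    (pop-jump-disjoint _ (suc r) u≤M)

  jumpPerms-unique : ∀ r M U → All (_≤ M) U → Unique (jumpPerms r M U)
  jumpPerms-unique zero M U _ = []
  jumpPerms-unique (suc r) M U U≤M = Unique.++⁺
    (Unique.map⁺ ∷-injectiveʳ (stackPerms-unique r (suc M) U U≤1+M))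
    (jumpPerms-unique r (suc M) (suc M ∷ U) (≤-refl ∷ U≤1+M))
    (pop-jump-disjoint _ r ≤-refl)
    where
    U≤1+M : All (_≤ suc M) U
    U≤1+M = All.map m≤n⇒m≤1+n U≤M

-- Gapless sequences

GaplessStep : List ℕ → ℕ → Set
GaplessStep pre a = ∀ {m x} → m ∈ pre → a ≤ x → x ≤ m → x ≡ a ⊎ x ∈ pre

ValidNext : List ℕ → ℕ → Set
ValidNext pre a = a ∉ pre × 1 ≤ a × GaplessStep pre a

GaplessFrom : List ℕ → List ℕ → Set
GaplessFrom pre [] = ⊤
GaplessFrom pre (a ∷ π) = ValidNext pre a × GaplessFrom (pre ∷ʳ a) π

GaplessFrom⇒ValidNext : GaplessFrom pre π → h < length π → ValidNext (pre ++ take h π) (nth π h)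
GaplessFrom⇒ValidNext {pre} {a ∷ π} {zero} (valid , _) _ = subst (λ p → ValidNext p a) (sym (++-identityʳ pre)) valid
GaplessFrom⇒ValidNext {pre} {a ∷ π} {suc h} (_ , gapless) (s≤s h<) =
  subst (λ p → ValidNext p (nth π h)) (++-assoc pre [ a ] (take h π)) (GaplessFrom⇒ValidNext gapless h<)

ValidNext⇒GaplessFrom : (∀ {h} → h < length π → ValidNext (pre ++ take h π) (nth π h)) → GaplessFrom pre π
ValidNext⇒GaplessFrom {[]} valid = tt
ValidNext⇒GaplessFrom {a ∷ π} {pre} valid =
  subst (λ p → ValidNext p a) (++-identityʳ pre) (valid (s≤s z≤n)) ,
  ValidNext⇒GaplessFrom λ h< → subst (λ p → ValidNext p (nth π _)) (sym (++-assoc pre [ a ] _)) (valid (s≤s h<))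

GaplessFrom⇒Unique : GaplessFrom pre π → Unique pre → Unique (pre ++ π)
GaplessFrom⇒Unique {pre} {[]} _ pre! = subst Unique (sym (++-identityʳ pre)) pre!
GaplessFrom⇒Unique {pre} {a ∷ π} ((a∉pre , _) , gapless) pre! =
  subst Unique (++-assoc pre [ a ] π) (GaplessFrom⇒Unique gapless (Unique-∷ʳ a∉pre pre!))

GaplessFrom⇒positive : GaplessFrom pre π → All (1 ≤_) π
GaplessFrom⇒positive {π = []} _ = []
GaplessFrom⇒positive {π = a ∷ π} ((_ , 1≤a , _) , gapless) = 1≤a ∷ GaplessFrom⇒positive gapless

GaplessStep-last : pre ⊆ range n → 1 ≤ a → range n ⊆ pre ∷ʳ a → GaplessStep pre a
GaplessStep-last pre⊆range 1≤a range⊆ m∈pre a≤x x≤m =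
  swap (∈-∷ʳ⁻ (range⊆ (∈-range⁺ (≤-trans 1≤a a≤x) (≤-trans x≤m (proj₂ (∈-range⁻ (pre⊆range m∈pre)))))))

-- pre has been output, M is the largest value received and U is the stack.
record StackState (pre : List ℕ) (M : ℕ) (U : List ℕ) : Set where
  field
    output-unique    : Unique pre
    output-range     : pre ⊆ range M
    stack-range      : U ⊆ range M
    stack-fresh      : x ∈ U → x ∉ pre
    stack-complete   : x ∈ range M → x ∉ pre → x ∈ U
    stack-decreasing : AllPairs _>_ U
open StackState

StackState-initial : StackState [] 0 []
StackState-initial = record
  { output-unique = [] ; output-range = λ () ; stack-range = λ () ; stack-fresh = λ ()
  ; stack-complete = λ () ; stack-decreasing = [] }

StackState-pop : StackState pre M (u ∷ U) → StackState (pre ∷ʳ u) M U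
StackState-pop {pre} {M} {u} {U} S = record
  { output-unique = Unique-∷ʳ (stack-fresh S (here refl)) (output-unique S)
  ; output-range = λ x∈ → [ output-range S , (λ { refl → stack-range S (here refl) }) ]′ (∈-∷ʳ⁻ x∈)
  ; stack-range = stack-range S ∘ there
  ; stack-fresh = fresh
  ; stack-complete = complete
  ; stack-decreasing = AllPairs.tail (stack-decreasing S) }
  where
  fresh : x ∈ U → x ∉ pre ∷ʳ u
  fresh x∈U x∈ with ∈-∷ʳ⁻ x∈
  ... | inj₁ x∈pre = stack-fresh S (there x∈U) x∈pre
  ... | inj₂ refl = <-irrefl refl (All.lookup (AllPairs.head (stack-decreasing S)) x∈U)
  complete : x ∈ range M → x ∉ pre ∷ʳ u → x ∈ U
  complete x∈ x∉ with stack-complete S x∈ (x∉ ∘ ∈-++⁺ˡ)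
  ... | here refl = contradiction ∈-∷ʳ x∉
  ... | there x∈U = x∈U

suc-∉-output : StackState pre M U → suc M ∉ pre
suc-∉-output S 1+M∈pre = 1+n≰n (proj₂ (∈-range⁻ (output-range S 1+M∈pre)))

StackState-push : StackState pre M U → StackState pre (suc M) (suc M ∷ U)
StackState-push {pre} {M} {U} S = record
  { output-unique = output-unique S
  ; output-range = range-⊆-suc ∘ output-range S
  ; stack-range = λ { (here refl) → ∈-range⁺ (s≤s z≤n) ≤-refl ; (there x∈U) → range-⊆-suc (stack-range S x∈U) }
  ; stack-fresh = λ { (here refl) → suc-∉-output S ; (there x∈U) → stack-fresh S x∈U }
  ; stack-complete = complete
  ; stack-decreasing = All.tabulate (λ x∈U → s≤s (proj₂ (∈-range⁻ (stack-range S x∈U)))) ∷ stack-decreasing S }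
  where
  complete : x ∈ range (suc M) → x ∉ pre → x ∈ suc M ∷ U
  complete x∈ x∉pre with ∈-range-suc x∈
  ... | inj₁ x∈range = there (stack-complete S x∈range x∉pre)
  ... | inj₂ refl = here refl

StackState-receive : StackState pre M U → StackState (pre ∷ʳ suc M) (suc M) U
StackState-receive {pre} {M} {U} S = record
  { output-unique = Unique-∷ʳ (suc-∉-output S) (output-unique S)
  ; output-range = λ x∈ →
      [ range-⊆-suc ∘ output-range S , (λ { refl → ∈-range⁺ (s≤s z≤n) ≤-refl }) ]′ (∈-∷ʳ⁻ x∈)
  ; stack-range = range-⊆-suc ∘ stack-range S
  ; stack-fresh = fresh
  ; stack-complete = complete
  ; stack-decreasing = stack-decreasing S }
  where
  fresh : x ∈ U → x ∉ pre ∷ʳ suc M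
  fresh x∈U x∈ with ∈-∷ʳ⁻ x∈
  ... | inj₁ x∈pre = stack-fresh S x∈U x∈pre
  ... | inj₂ refl = 1+n≰n (proj₂ (∈-range⁻ (stack-range S x∈U)))
  complete : x ∈ range (suc M) → x ∉ pre ∷ʳ suc M → x ∈ U
  complete x∈ x∉ with ∈-range-suc x∈
  ... | inj₁ x∈range = stack-complete S x∈range (x∉ ∘ ∈-++⁺ˡ)
  ... | inj₂ refl = contradiction ∈-∷ʳ x∉

ValidNext-pop : StackState pre M (u ∷ U) → ValidNext pre u
ValidNext-pop {pre} {M} {u} {U} S = stack-fresh S (here refl) , proj₁ (∈-range⁻ u∈range) , step
  where
  u∈range : u ∈ range M
  u∈range = stack-range S (here refl)
  step : GaplessStep pre u
  step {m} {x} m∈pre u≤x x≤m with x ∈? pre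
  ... | yes x∈pre = inj₂ x∈pre
  ... | no x∉pre with stack-complete S (∈-range⁺ (≤-trans (proj₁ (∈-range⁻ u∈range)) u≤x)
                                                 (≤-trans x≤m (proj₂ (∈-range⁻ (output-range S m∈pre))))) x∉pre
  ...   | here x≡u = inj₁ x≡u
  ...   | there x∈U = contradiction u≤x (<⇒≱ (All.lookup (AllPairs.head (stack-decreasing S)) x∈U))

ValidNext-receive : StackState pre M U → ValidNext pre (suc M)
ValidNext-receive S = suc-∉-output S , s≤s z≤n ,
  λ m∈pre 1+M≤x x≤m →
    contradiction (≤-trans 1+M≤x (≤-trans x≤m (proj₂ (∈-range⁻ (output-range S m∈pre))))) 1+n≰n

-- π is a gapless continuation of pre that outputs the r values still to come and the stack U.
Completion : ℕ → ℕ → List ℕ → List ℕ → List ℕ → Set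
Completion r M U pre π = GaplessFrom pre π × All (_≤ r + M) π × length π ≡ r + length U

Completion-pop : StackState pre M (u ∷ U) → Completion r M U (pre ∷ʳ u) ρ → Completion r M (u ∷ U) pre (u ∷ ρ)
Completion-pop {M = M} {r = r} S (gapless , bounded , |ρ|) =
  (ValidNext-pop S , gapless) ,
  ≤-trans (proj₂ (∈-range⁻ (stack-range S (here refl)))) (m≤n+m M r) ∷ bounded ,
  trans (cong suc |ρ|) (sym (+-suc r _))

Completion-receive : StackState pre M U → Completion r (suc M) U (pre ∷ʳ suc M) ρ → Completion (suc r) M U pre (suc M ∷ ρ)
Completion-receive {M = M} {r = r} S (gapless , bounded , |ρ|) =
  (ValidNext-receive S , gapless) , s≤s (m≤n+m M r) ∷ All.map (λ x≤ → ≤-trans x≤ (≤-reflexive (+-suc r M))) bounded ,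
  cong suc |ρ|

Completion-push : Completion r (suc M) (suc M ∷ U) pre π → Completion (suc r) M U pre π
Completion-push {r = r} {M = M} {U = U} (gapless , bounded , |π|) =
  gapless , All.map (λ x≤ → ≤-trans x≤ (≤-reflexive (+-suc r M))) bounded , trans |π| (+-suc r (length U))

mutual
  stackPerms-sound : ∀ r → StackState pre M U → π ∈ stackPerms r M U → Completion r M U pre π
  stackPerms-sound {U = []} zero S (here refl) = tt , [] , refl
  stackPerms-sound {U = u ∷ U} zero S p with ∈-map⁻ (u ∷_) p
  ... | ρ , q , refl = Completion-pop S (stackPerms-sound zero (StackState-pop S) q)
  stackPerms-sound {U = []} (suc r) S p = jumpPerms-sound (suc r) S p
  stackPerms-sound {M = M} {U = u ∷ U} (suc r) S p with ∈-++⁻ (map (u ∷_) (stackPerms (suc r) M U)) p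
  ... | inj₂ q = jumpPerms-sound (suc r) S q
  ... | inj₁ q with ∈-map⁻ (u ∷_) q
  ...   | ρ , q′ , refl = Completion-pop S (stackPerms-sound (suc r) (StackState-pop S) q′)

  jumpPerms-sound : ∀ r → StackState pre M U → π ∈ jumpPerms r M U → Completion r M U pre π
  jumpPerms-sound {M = M} {U = U} (suc r) S p with ∈-++⁻ (map (suc M ∷_) (stackPerms r (suc M) U)) p
  ... | inj₂ q = Completion-push {U = U} (jumpPerms-sound r (StackState-push S) q)
  ... | inj₁ q with ∈-map⁻ (suc M ∷_) q
  ...   | ρ , q′ , refl = Completion-receive S (stackPerms-sound r (StackState-receive S) q′)

pushes : ℕ → ℕ → List ℕ → List ℕ
pushes zero M U = U
pushes (suc t) M U = pushes t (suc M) (suc M ∷ U)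

StackState-pushes : ∀ t → StackState pre M U → StackState pre (t + M) (pushes t M U)
StackState-pushes zero S = S
StackState-pushes {pre} {M} {U} (suc t) S =
  subst (λ K → StackState pre K (pushes (suc t) M U)) (+-suc t M) (StackState-pushes t (StackState-push S))

length-pushes : ∀ t M U → length (pushes t M U) ≡ t + length U
length-pushes zero M U = refl
length-pushes (suc t) M U = trans (length-pushes t (suc M) (suc M ∷ U)) (+-suc t (length U))

∈-jumpPerms-pushes : ∀ t → ρ ∈ stackPerms r (suc (t + M)) (pushes t M U) → suc (t + M) ∷ ρ ∈ jumpPerms (suc (t + r)) M U
∈-jumpPerms-pushes {M = M} {U = U} zero p = ∈-++⁺ˡ (∈-map⁺ (suc M ∷_) p)
∈-jumpPerms-pushes {ρ = ρ} {r = r} {M = M} {U = U} (suc t) p =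
  ∈-++⁺ʳ (map (suc M ∷_) (stackPerms (suc (t + r)) (suc M) U))
    (subst (λ K → suc K ∷ ρ ∈ jumpPerms (suc (t + r)) (suc M) (suc M ∷ U)) (+-suc t M)
      (∈-jumpPerms-pushes t (subst (λ K → ρ ∈ stackPerms r (suc K) (pushes (suc t) M U)) (sym (+-suc t M)) p)))

∈-stackPerms-pop : ∀ r → ρ ∈ stackPerms r M U → u ∷ ρ ∈ stackPerms r M (u ∷ U)
∈-stackPerms-pop {u = u} zero p = ∈-map⁺ (u ∷_) p
∈-stackPerms-pop {u = u} (suc r) p = ∈-++⁺ˡ (∈-map⁺ (u ∷_) p)

jumpPerms⊆stackPerms : ∀ r → π ∈ jumpPerms r M U → π ∈ stackPerms r M U
jumpPerms⊆stackPerms {U = []} (suc r) p = p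
jumpPerms⊆stackPerms {M = M} {U = u ∷ U} (suc r) p = ∈-++⁺ʳ (map (u ∷_) (stackPerms (suc r) M U)) p

stack-top : StackState pre M U → M ∈ pre → ValidNext pre a → a ≤ M → ∃[ U′ ] U ≡ a ∷ U′
stack-top {U = []} S _ (a∉pre , 1≤a , _) a≤M with stack-complete S (∈-range⁺ 1≤a a≤M) a∉pre
... | ()
stack-top {M = M} {U = u ∷ U′} {a = a} S M∈pre (a∉pre , 1≤a , step) a≤M
  with stack-complete S (∈-range⁺ 1≤a a≤M) a∉pre
... | here refl = U′ , refl
... | there a∈U′ = ⊥-elim ([ <⇒≢ a<u ∘ sym , stack-fresh S (here refl) ]′
                             (step M∈pre (<⇒≤ a<u) (proj₂ (∈-range⁻ (stack-range S (here refl))))))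
  where
  a<u : a < u
  a<u = All.lookup (AllPairs.head (stack-decreasing S)) a∈U′

above : M < a → ∃[ t ] a ≡ suc (t + M)
above {M} {suc a} (s≤s M≤a) = a ∸ M , cong suc (sym (m∸n+n≡m M≤a))

below : t < r → ∃[ r′ ] r ≡ suc (t + r′)
below {t} {suc r} (s≤s t≤r) = r ∸ t , cong suc (sym (m+[n∸m]≡n t≤r))

stackPerms-complete : ∀ r → StackState pre M U → (M ≡ 0 ⊎ M ∈ pre) → Completion r M U pre π → π ∈ stackPerms r M U
stackPerms-complete {U = []} {π = []} zero _ _ _ = here refl
stackPerms-complete {U = _ ∷ _} {π = []} zero _ _ (_ , _ , ())
stackPerms-complete {π = []} (suc r) _ _ (_ , _ , ())
stackPerms-complete {M = M} {π = a ∷ ρ} r S M-max ((valid , gapless) , a≤r+M ∷ bounded , |aρ|) with a ≤? M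
... | yes a≤M with stack-top S (M-output M-max) valid a≤M
  where
  M-output : M ≡ 0 ⊎ M ∈ pre → M ∈ pre
  M-output (inj₁ refl) = contradiction (≤-trans (proj₁ (proj₂ valid)) a≤M) λ ()
  M-output (inj₂ M∈pre) = M∈pre
...   | U′ , refl = ∈-stackPerms-pop r
        (stackPerms-complete r (StackState-pop S) (map₂ ∈-++⁺ˡ M-max)
          (gapless , bounded , suc-injective (trans |aρ| (+-suc r _))))
stackPerms-complete {M = M} {U = U} {π = a ∷ ρ} r S M-max ((valid , gapless) , a≤r+M ∷ bounded , |aρ|) | no a≰M
  with above (≰⇒> a≰M)
... | t , refl with below {t = t} {r = r} (+-cancelʳ-≤ M (suc t) r a≤r+M)
...   | r′ , refl = jumpPerms⊆stackPerms r (∈-jumpPerms-pushes t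
          (stackPerms-complete r′ (StackState-receive (StackState-pushes t S)) (inj₂ ∈-∷ʳ)
            (gapless , All.map (λ x≤ → ≤-trans x≤ (≤-reflexive (e₁ t r′ M))) bounded , |ρ|)))
  where
  e₁ : ∀ t r′ M → suc (t + r′) + M ≡ r′ + suc (t + M)
  e₁ = solve-∀
  e₂ : ∀ t r′ u → t + r′ + u ≡ r′ + (t + u)
  e₂ = solve-∀
  |ρ| : length ρ ≡ r′ + length (pushes t M U)
  |ρ| = trans (suc-injective |aρ|) (trans (e₂ t r′ (length U)) (cong (r′ +_) (sym (length-pushes t M U))))

∈-stackPerms⁻ : ∀ n → π ∈ stackPerms n 0 [] → IsPermutation n π × GaplessFrom [] π
∈-stackPerms⁻ n π∈ with stackPerms-sound n StackState-initial π∈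
... | gapless , bounded , |π| = record
  { unique = GaplessFrom⇒Unique gapless []
  ; length≡ = trans |π| (+-identityʳ n)
  ; ⊆range = λ x∈ → ∈-range⁺ (All.lookup (GaplessFrom⇒positive gapless) x∈)
                              (≤-trans (All.lookup bounded x∈) (≤-reflexive (+-identityʳ n))) }
  , gapless

∈-stackPerms⁺ : IsPermutation n π → GaplessFrom [] π → π ∈ stackPerms n 0 []
∈-stackPerms⁺ {n} P gapless = stackPerms-complete n StackState-initial (inj₁ refl)
  (gapless , All.tabulate (λ x∈ → ≤-trans (proj₂ (∈-range⁻ (⊆range P x∈))) (≤-reflexive (sym (+-identityʳ n)))) ,
   trans (length≡ P) (sym (+-identityʳ n)))

-- Shapes of strict partitions

colLen-∷ : ∀ z (zs : Vec ℕ n) j →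
  (j < z × colLen (z ∷ zs) j ≡ suc (colLen zs j)) ⊎ (z ≤ j × colLen (z ∷ zs) j ≡ colLen zs j)
colLen-∷ z zs j with j <ᵇ z in eq
... | true = inj₁ (<ᵇ⇒< j z (subst T (sym eq) tt) , refl)
... | false = inj₂ (≮⇒≥ (λ j<z → subst T eq (<⇒<ᵇ j<z)) , refl)

StrictPartition-tail : ∀ z (zs : Vec ℕ n) → StrictPartition (z ∷ zs) → StrictPartition zs
StrictPartition-tail z zs sp i i′ i<i′ = sp (fsuc i) (fsuc i′) (s≤s i<i′)

StrictPartition-head : ∀ z (zs : Vec ℕ n) → StrictPartition (z ∷ zs) → ∀ i → lookup zs i < z
StrictPartition-head z zs sp i = sp fzero (fsuc i) (s≤s z≤n)

colLen≡0 : ∀ (la : Vec ℕ n) → (∀ i → lookup la i ≤ j) → colLen la j ≡ 0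
colLen≡0 [] _ = refl
colLen≡0 {j = j} (z ∷ zs) la≤j with colLen-∷ z zs j
... | inj₁ (j<z , _) = contradiction (la≤j fzero) (<⇒≱ j<z)
... | inj₂ (_ , eq) = trans eq (colLen≡0 zs (la≤j ∘ fsuc))

colLen≤ : ∀ (la : Vec ℕ n) j → colLen la j ≤ n
colLen≤ [] j = z≤n
colLen≤ {suc n} (z ∷ zs) j with colLen-∷ z zs j
... | inj₁ (_ , eq) = ≤-trans (≤-reflexive eq) (s≤s (colLen≤ zs j))
... | inj₂ (_ , eq) = ≤-trans (≤-reflexive eq) (m≤n⇒m≤1+n (colLen≤ zs j))

colLen-antitone : ∀ (la : Vec ℕ n) → j ≤ k → colLen la k ≤ colLen la j
colLen-antitone [] _ = z≤n
colLen-antitone {j = j} {k} (z ∷ zs) j≤k with colLen-∷ z zs j | colLen-∷ z zs k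
... | inj₁ (_ , eq) | inj₁ (_ , eq′) = subst₂ _≤_ (sym eq′) (sym eq) (s≤s (colLen-antitone zs j≤k))
... | inj₁ (_ , eq) | inj₂ (_ , eq′) = subst₂ _≤_ (sym eq′) (sym eq) (m≤n⇒m≤1+n (colLen-antitone zs j≤k))
... | inj₂ (z≤j , _) | inj₁ (k<z , _) = contradiction (≤-trans z≤j j≤k) (<⇒≱ k<z)
... | inj₂ (_ , eq) | inj₂ (_ , eq′) = subst₂ _≤_ (sym eq′) (sym eq) (colLen-antitone zs j≤k)

inShape⇒<colLen : ∀ (la : Vec ℕ n) → StrictPartition la → ∀ {i j} → j < lookup la i → toℕ i < colLen la j
inShape⇒<colLen (z ∷ zs) sp {fzero} {j} j< with colLen-∷ z zs j
... | inj₁ (_ , eq) = ≤-trans (s≤s z≤n) (≤-reflexive (sym eq))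
... | inj₂ (z≤j , _) = contradiction z≤j (<⇒≱ j<)
inShape⇒<colLen (z ∷ zs) sp {fsuc i} {j} j< with colLen-∷ z zs j
... | inj₁ (_ , eq) = ≤-trans (s≤s (inShape⇒<colLen zs (StrictPartition-tail z zs sp) j<)) (≤-reflexive (sym eq))
... | inj₂ (z≤j , _) = contradiction (<-trans j< (StrictPartition-head z zs sp i)) (≤⇒≯ z≤j)

<colLen⇒inShape : ∀ (la : Vec ℕ n) → StrictPartition la → ∀ {i j} → toℕ i < colLen la j → j < lookup la i
<colLen⇒inShape (z ∷ zs) sp {i} {j} i< with colLen-∷ z zs j
<colLen⇒inShape (z ∷ zs) sp {fzero} i< | inj₁ (j<z , _) = j<z
<colLen⇒inShape (z ∷ zs) sp {fsuc i} i< | inj₁ (_ , eq) =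
  <colLen⇒inShape zs (StrictPartition-tail z zs sp) (≤-pred (≤-trans i< (≤-reflexive eq)))
... | inj₂ (z≤j , eq) =
  contradiction (trans eq (colLen≡0 zs λ i′ → <⇒≤ (<-≤-trans (StrictPartition-head z zs sp i′) z≤j))) (>⇒≢ (≤-trans (s≤s z≤n) i<))

colLen-lookup : ∀ (la : Vec ℕ n) → StrictPartition la → ∀ i → colLen la (lookup la i) ≡ toℕ i
colLen-lookup (z ∷ zs) sp fzero with colLen-∷ z zs z
... | inj₁ (z<z , _) = contradiction z<z (<-irrefl refl)
... | inj₂ (_ , eq) = trans eq (colLen≡0 zs (<⇒≤ ∘ StrictPartition-head z zs sp))
colLen-lookup (z ∷ zs) sp (fsuc i) with colLen-∷ z zs (lookup zs i)
... | inj₁ (_ , eq) = trans eq (cong suc (colLen-lookup zs (StrictPartition-tail z zs sp) i))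
... | inj₂ (z≤j , _) = contradiction (StrictPartition-head z zs sp i) (≤⇒≯ z≤j)

1≤h∧h≤n∸2⇒1+h<n : 1 ≤ h → h ≤ n ∸ 2 → suc h < n
1≤h∧h≤n∸2⇒1+h<n {n = suc (suc n)} _ h≤n = s≤s (s≤s h≤n)
1≤h∧h≤n∸2⇒1+h<n {n = zero} (s≤s _) ()
1≤h∧h≤n∸2⇒1+h<n {n = suc zero} (s≤s _) ()

rowAt : ∀ {m} → Vec (List ℕ) m → ℕ → List ℕ
rowAt [] _ = []
rowAt (row ∷ T) zero = row
rowAt (row ∷ T) (suc i) = rowAt T i

rowAt-toℕ : ∀ {m} (T : Vec (List ℕ) m) (i : Fin m) → rowAt T (toℕ i) ≡ lookup T i
rowAt-toℕ (row ∷ T) fzero = refl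
rowAt-toℕ (row ∷ T) (fsuc i) = rowAt-toℕ T i

-- Columns and keys

module _ {n} (la : Vec ℕ n) (sp : StrictPartition la) where

  <colLen⇒<n : i < colLen la j → i < n
  <colLen⇒<n i< = <-≤-trans i< (colLen≤ la _)

  colLen-fromℕ< : (h<n : h < n) → colLen la (lookup la (fromℕ< h<n)) ≡ h
  colLen-fromℕ< h<n = trans (colLen-lookup la sp _) (toℕ-fromℕ< h<n)

  lookup-fromℕ<-suc : (h+1<n : suc h < n) → lookup la (fromℕ< h+1<n) < lookup la (fromℕ< (<-trans (n<1+n h) h+1<n))
  lookup-fromℕ<-suc {h} h+1<n = sp _ _ (subst₂ _<_ (sym (toℕ-fromℕ< _)) (sym (toℕ-fromℕ< h+1<n)) (n<1+n h))

  inShape-fromℕ< : (i<colLen : i < colLen la j) → j < lookup la (fromℕ< (<colLen⇒<n i<colLen))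
  inShape-fromℕ< i<colLen = <colLen⇒inShape la sp (subst (_< colLen la _) (sym (toℕ-fromℕ< _)) i<colLen)

  column : Filling n → ℕ → List ℕ
  column T j = applyUpTo (λ i → nth (rowAt T i) j) (colLen la j)

  nth-column : ∀ T {i j} → j < lookup la i → nth (column T j) (toℕ i) ≡ ent T i j
  nth-column T {i} {j} j< =
    trans (nth-applyUpTo _ (inShape⇒<colLen la sp j<)) (cong (λ row → nth row j) (rowAt-toℕ T i))

  nth-rowAt : ∀ T (i<colLen : i < colLen la j) → nth (rowAt T i) j ≡ ent T (fromℕ< (<colLen⇒<n i<colLen)) j
  nth-rowAt {i} {j} T i<colLen = trans (cong (λ i′ → nth (rowAt T i′) j) (sym (toℕ-fromℕ< (<colLen⇒<n i<colLen))))
                                       (cong (λ row → nth row j) (rowAt-toℕ T _))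

  ∈-column⁻ : ∀ T → x ∈ column T j → InColumn la T j x
  ∈-column⁻ {j = j} T x∈ with ∈-applyUpTo⁻ (λ i → nth (rowAt T i) j) x∈
  ... | i , i<colLen , refl = fromℕ< (<colLen⇒<n i<colLen) , inShape-fromℕ< i<colLen , sym (nth-rowAt T i<colLen)

  ∈-column⁺ : ∀ T → InColumn la T j x → x ∈ column T j
  ∈-column⁺ {j} T (i , j< , refl) =
    subst (_∈ column T j) (nth-column T j<)
      (nth-∈ (subst (toℕ i <_) (sym (length-applyUpTo _ (colLen la j))) (inShape⇒<colLen la sp j<)))

  column-increasing : ∀ T → IsTableau la T → ∀ j → AllPairs _<_ (column T j)
  column-increasing T (_ , _ , column-strict , _) j = AllPairs.applyUpTo⁺₁ _ (colLen la j) strict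
    where
    strict : ∀ {i i′} → i < i′ → i′ < colLen la j → nth (rowAt T i) j < nth (rowAt T i′) j
    strict {i} {i′} i<i′ i′< = subst₂ _<_ (sym (nth-rowAt T i<)) (sym (nth-rowAt T i′<))
      (column-strict _ _ j (subst₂ _<_ (sym (toℕ-fromℕ< _)) (sym (toℕ-fromℕ< _)) i<i′)
        (inShape-fromℕ< i<) (inShape-fromℕ< i′<))
      where
      i< : i < colLen la j
      i< = <-trans i<i′ i′<

  tableau-ext : ∀ {T T′} → IsTableau la T → IsTableau la T′ →
    (∀ {j x} → InColumn la T j x → InColumn la T′ j x) → (∀ {j x} → InColumn la T′ j x → InColumn la T j x) →
    T ≡ T′
  tableau-ext {T} {T′} tab tab′ T⊆T′ T′⊆T =
    trans (sym (tabulate∘lookup T)) (trans (tabulate-cong rows≡) (tabulate∘lookup T′))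
    where
    columns≡ : ∀ j → column T j ≡ column T′ j
    columns≡ j = strictlyIncreasing-≐ (column-increasing T tab j) (column-increasing T′ tab′ j)
      (∈-column⁺ T′ ∘ T⊆T′ ∘ ∈-column⁻ T , ∈-column⁺ T ∘ T′⊆T ∘ ∈-column⁻ T′)
    rows≡ : ∀ i → lookup T i ≡ lookup T′ i
    rows≡ i = nth-ext (trans (proj₁ tab i) (sym (proj₁ tab′ i))) λ {j} j< →
      let j<λ = subst (j <_) (proj₁ tab i) j< in
      trans (sym (nth-column T j<λ)) (trans (cong (λ c → nth c (toℕ i)) (columns≡ j)) (nth-column T′ j<λ))

  fromColumns : (ℕ → List ℕ) → Filling n
  fromColumns col = tabulate λ i → applyUpTo (λ j → nth (col j) (toℕ i)) (lookup la i)

  ent-fromColumns : ∀ col {i j} → j < lookup la i → ent (fromColumns col) i j ≡ nth (col j) (toℕ i)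
  ent-fromColumns col {i} j< = trans (cong (λ row → nth row _) (lookup∘tabulate _ i)) (nth-applyUpTo _ j<)

  record KeyColumns (col : ℕ → List ℕ) : Set where
    field
      increasing : ∀ j → AllPairs _<_ (col j)
      bounded : ∀ j → col j ⊆ range n
      length≡colLen : ∀ j → length (col j) ≡ colLen la j
      nested : j ≤ k → col k ⊆ col j
  open KeyColumns

  module _ {col : ℕ → List ℕ} (K : KeyColumns col) where

    <length-column : ∀ {i : Fin n} {j} → j < lookup la i → toℕ i < length (col j)
    <length-column j< = subst (_ <_) (sym (length≡colLen K _)) (inShape⇒<colLen la sp j<)

    InColumn-fromColumns⁻ : InColumn la (fromColumns col) j x → x ∈ col j
    InColumn-fromColumns⁻ (i , j< , refl) = subst (_∈ col _) (sym (ent-fromColumns col j<)) (nth-∈ (<length-column j<))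

    InColumn-fromColumns⁺ : x ∈ col j → InColumn la (fromColumns col) j x
    InColumn-fromColumns⁺ {j = j} x∈ with ∈⇒nth x∈
    ... | i , i< , refl = fromℕ< (<colLen⇒<n i<colLen) , inShape-fromℕ< i<colLen ,
                          trans (ent-fromColumns col (inShape-fromℕ< i<colLen)) (cong (nth (col j)) (toℕ-fromℕ< _))
      where
      i<colLen : i < colLen la j
      i<colLen = subst (i <_) (length≡colLen K j) i<

    fromColumns-isKey : IsKey la (fromColumns col)
    fromColumns-isKey = (row-lengths , bounds , column-strict , row-weak) , nested-columns
      where
      row-lengths : ∀ i → length (lookup (fromColumns col) i) ≡ lookup la i
      row-lengths i = trans (cong length (lookup∘tabulate _ i)) (length-applyUpTo _ (lookup la i))
      bounds : ∀ i j → j < lookup la i → 1 ≤ ent (fromColumns col) i j × ent (fromColumns col) i j ≤ n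
      bounds i j j< = ∈-range⁻ (bounded K j (InColumn-fromColumns⁻ (i , j< , refl)))
      column-strict : ∀ i i′ j → toℕ i < toℕ i′ → j < lookup la i → j < lookup la i′
                      → ent (fromColumns col) i j < ent (fromColumns col) i′ j
      column-strict i i′ j i<i′ j< j<′ = subst₂ _<_ (sym (ent-fromColumns col j<)) (sym (ent-fromColumns col j<′))
        (nth-increasing (increasing K j) i<i′ (<length-column j<′))
      row-weak : ∀ i j j′ → j ≤ j′ → j′ < lookup la i → ent (fromColumns col) i j ≤ ent (fromColumns col) i j′
      row-weak i j j′ j≤j′ j′< =
        subst₂ _≤_ (sym (ent-fromColumns col (≤-<-trans j≤j′ j′<))) (sym (ent-fromColumns col j′<)) (nth-⊆ (increasing K j′) (increasing K j) (nested K j≤j′) (<length-column j′<))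
      nested-columns : ∀ l j x → l ≤ j → InColumn la (fromColumns col) j x → InColumn la (fromColumns col) l x
      nested-columns l j x l≤j = InColumn-fromColumns⁺ ∘ nested K l≤j ∘ InColumn-fromColumns⁻

  -- The columns of length h of the key of π hold the first h entries of π.

  prefixColumn : List ℕ → ℕ → List ℕ
  prefixColumn π h = filter (_∈? take h π) (range n)

  keyOf : List ℕ → Filling n
  keyOf π = fromColumns (λ j → prefixColumn π (colLen la j))

  module _ {π} (P : IsPermutation n π) where

    prefixColumn-≐ : ∀ h → prefixColumn π h ≐ take h π
    prefixColumn-≐ h = proj₂ ∘ ∈-filter⁻ (_∈? take h π) {xs = range n} ,
                       λ x∈ → ∈-filter⁺ (_∈? take h π) (⊆range P (∈-take⁻ h x∈)) x∈

    length-take-≤ : h ≤ n → length (take h π) ≡ h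
    length-take-≤ {h} h≤n = trans (length-take h π) (m≤n⇒m⊓n≡m (subst (h ≤_) (sym (length≡ P)) h≤n))

    keyColumns : KeyColumns (λ j → prefixColumn π (colLen la j))
    keyColumns = record
      { increasing = λ j → AllPairs.filter⁺ (_∈? take (colLen la j) π) (range-increasing {n})
      ; bounded = λ j → proj₁ ∘ ∈-filter⁻ (_∈? take (colLen la j) π) {xs = range n}
      ; length≡colLen = λ j →
          trans (length-≐ (Unique.filter⁺ _ (range-unique {n})) (Unique.take⁺ _ (unique P)) (prefixColumn-≐ (colLen la j)))
                (length-take-≤ (colLen≤ la j))
      ; nested = λ j≤k → proj₂ (prefixColumn-≐ _) ∘ take-mono (colLen-antitone la j≤k) ∘ proj₁ (prefixColumn-≐ _)
      }

    InColumn-keyOf⁻ : InColumn la (keyOf π) j x → x ∈ take (colLen la j) π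
    InColumn-keyOf⁻ = proj₁ (prefixColumn-≐ _) ∘ InColumn-fromColumns⁻ keyColumns

    InColumn-keyOf⁺ : x ∈ take (colLen la j) π → InColumn la (keyOf π) j x
    InColumn-keyOf⁺ = InColumn-fromColumns⁺ keyColumns ∘ proj₂ (prefixColumn-≐ _)

    InColsOfLen-keyOf⁻ : InColsOfLen la (keyOf π) h x → x ∈ take h π
    InColsOfLen-keyOf⁻ (j , refl , x∈) = InColumn-keyOf⁻ x∈

    InColsOfLen-keyOf⁺ : h < n → x ∈ take h π → InColsOfLen la (keyOf π) h x
    InColsOfLen-keyOf⁺ {h} {x} h<n x∈ =
      lookup la (fromℕ< h<n) , colLen-fromℕ< h<n ,
      InColumn-keyOf⁺ (subst (λ h → x ∈ take h π) (sym (colLen-fromℕ< h<n)) x∈)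

    keyOf-gaplessKey : GaplessFrom [] π → IsGaplessKey la (keyOf π)
    keyOf-gaplessKey gapless = fromColumns-isKey keyColumns , gaplessAt
      where
      gaplessAt : ∀ h → 1 ≤ h → h ≤ n ∸ 2 → GaplessAt la (keyOf π) h
      gaplessAt h 1≤h h≤n-2 b m (b-in , b-new , _) (m-in , _) _ x b≤x x≤m = InColsOfLen-keyOf⁺ 1+h<n x∈
        where
        1+h<n : suc h < n
        1+h<n = 1≤h∧h≤n∸2⇒1+h<n 1≤h h≤n-2
        h<|π| : h < length π
        h<|π| = subst (h <_) (sym (length≡ P)) (<-trans (n<1+n h) 1+h<n)
        b≡ : b ≡ nth π h
        b≡ with ∈-∷ʳ⁻ (subst (b ∈_) (take-suc-nth h<|π|) (InColsOfLen-keyOf⁻ b-in))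
        ... | inj₁ b∈ = contradiction (InColsOfLen-keyOf⁺ (<-trans (n<1+n h) 1+h<n) b∈) b-new
        ... | inj₂ b≡ = b≡
        x∈ : x ∈ take (suc h) π
        x∈ with proj₂ (proj₂ (GaplessFrom⇒ValidNext gapless h<|π|)) (InColsOfLen-keyOf⁻ m-in) (subst (_≤ x) b≡ b≤x) x≤m
        ... | inj₁ refl = subst (nth π h ∈_) (sym (take-suc-nth h<|π|)) ∈-∷ʳ
        ... | inj₂ x∈′ = subst (x ∈_) (sym (take-suc-nth h<|π|)) (∈-++⁺ˡ x∈′)

  keyOf-injective : ∀ {π π′} → IsPermutation n π → IsPermutation n π′ → keyOf π ≡ keyOf π′ → π ≡ π′
  keyOf-injective {π} {π′} P P′ keys≡ = prefix⊆⇒≡ (unique P) (trans (length≡ P) (sym (length≡ P′))) prefix⊆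
    where
    prefix⊆ : ∀ h → take h π ⊆ take h π′
    prefix⊆ h {x} x∈ with h <? n
    ... | yes h<n = InColsOfLen-keyOf⁻ P′ (subst (λ T → InColsOfLen la T h x) keys≡ (InColsOfLen-keyOf⁺ P h<n x∈))
    ... | no h≮n = subst (x ∈_) (sym (take-all h π′ (≤-trans (≤-reflexive (length≡ P′)) (≮⇒≥ h≮n))))
                     (fills-range (unique P′) (length≡ P′) (⊆range P′) (⊆range P (∈-take⁻ h x∈)))

  module _ {T} (G : IsGaplessKey la T) where

    private
      tableau : IsTableau la T
      tableau = proj₁ (proj₁ G)
      columns-nested : (l j x : ℕ) → l ≤ j → InColumn la T j x → InColumn la T l x
      columns-nested = proj₂ (proj₁ G)
      gaplessAt : (h : ℕ) → 1 ≤ h → h ≤ n ∸ 2 → GaplessAt la T h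
      gaplessAt = proj₂ G

    column-⊆-range : column T j ⊆ range n
    column-⊆-range {j} x∈ with ∈-column⁻ T x∈
    ... | i , j< , refl = ∈-range⁺ (proj₁ (proj₁ (proj₂ tableau) i j j<)) (proj₂ (proj₁ (proj₂ tableau) i j j<))

    column-nested : j ≤ k → column T k ⊆ column T j
    column-nested j≤k = ∈-column⁺ T ∘ columns-nested _ _ _ j≤k ∘ ∈-column⁻ T

    column-unique : Unique (column T j)
    column-unique {j} = strictlyIncreasing⇒Unique (column-increasing T tableau j)

    length-column : length (column T j) ≡ colLen la j
    length-column {j} = length-applyUpTo _ (colLen la j)

    column-⊆-equal-length : colLen la j ≡ colLen la k → column T j ⊆ column T k
    column-⊆-equal-length {j} {k} same with ≤-total k j
    ... | inj₁ k≤j = column-nested k≤j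
    ... | inj₂ j≤k = ⊆-length⇒⊇ column-unique column-unique (column-nested j≤k)
                       (≤-reflexive (trans length-column (trans same (sym length-column))))

    flag : ℕ → List ℕ
    flag h with h <? n
    ... | yes h<n = column T (lookup la (fromℕ< h<n))
    ... | no _ = range n

    flag-n : flag n ≡ range n
    flag-n with n <? n
    ... | yes n<n = contradiction n<n (<-irrefl refl)
    ... | no _ = refl

    column-≐-flag : ∀ j → column T j ≐ flag (colLen la j)
    column-≐-flag j with colLen la j <? n
    ... | yes h<n = column-⊆-equal-length (sym (colLen-fromℕ< h<n)) , column-⊆-equal-length (colLen-fromℕ< h<n)
    ... | no h≮n = column-⊆-range , fills-range column-unique (trans length-column colLen≡n) column-⊆-range
      where
      colLen≡n : colLen la j ≡ n
      colLen≡n = ≤-antisym (colLen≤ la j) (≮⇒≥ h≮n)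

    flag-unique : h ≤ n → Unique (flag h)
    flag-unique {h} _ with h <? n
    ... | yes _ = column-unique
    ... | no _ = range-unique

    flag-length : h ≤ n → length (flag h) ≡ h
    flag-length {h} h≤n with h <? n
    ... | yes h<n = trans length-column (colLen-fromℕ< h<n)
    ... | no h≮n = trans (length-applyUpTo suc n) (≤-antisym (≮⇒≥ h≮n) h≤n)

    flag-nested : h < n → flag h ⊆ flag (suc h)
    flag-nested {h} h<n with h <? n | suc h <? n
    ... | no h≮n | _ = contradiction h<n h≮n
    ... | yes _ | no _ = column-⊆-range
    ... | yes _ | yes h+1<n = column-nested (<⇒≤ (lookup-fromℕ<-suc h+1<n))

    InColsOfLen⇒flag : InColsOfLen la T h x → x ∈ flag h
    InColsOfLen⇒flag (j , refl , x∈) = proj₁ (column-≐-flag j) (∈-column⁺ T x∈)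

    flag⇒InColsOfLen : h < n → x ∈ flag h → InColsOfLen la T h x
    flag⇒InColsOfLen {h} h<n x∈ with h <? n
    ... | yes h<n′ = _ , colLen-fromℕ< h<n′ , ∈-column⁻ T x∈
    ... | no h≮n = contradiction h<n h≮n

    GaplessStep-flag : 1 ≤ h → suc h < n → ∀ {pre a} →
      pre ≐ flag h → pre ∷ʳ a ≐ flag (suc h) → a ∉ pre → GaplessStep pre a
    GaplessStep-flag {h} 1≤h h+1<n {pre} {a} pre≐ pre∷ʳa≐ a∉pre {m} {x} m∈pre a≤x x≤m with a <? max m pre
    ... | no a≮mx = inj₁ (≤-antisym (≤-trans x≤m (≤-trans (All.lookup (xs≤max m pre) m∈pre) (≮⇒≥ a≮mx))) a≤x)
    ... | yes a<mx = swap (∈-∷ʳ⁻ (proj₂ pre∷ʳa≐ (InColsOfLen⇒flag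
          (gaplessAt h 1≤h (∸-monoˡ-≤ 2 h+1<n) a (max m pre) (a-in , a-new , a-least) (mx-in , mx-greatest) a<mx x a≤x
                 (≤-trans x≤m (All.lookup (xs≤max m pre) m∈pre))))))
      where
      h<n : h < n
      h<n = <-trans (n<1+n h) h+1<n
      a-in : InColsOfLen la T (suc h) a
      a-in = flag⇒InColsOfLen h+1<n (proj₁ pre∷ʳa≐ ∈-∷ʳ)
      a-new : ¬ InColsOfLen la T h a
      a-new = a∉pre ∘ proj₂ pre≐ ∘ InColsOfLen⇒flag
      a-least : ∀ y → InColsOfLen la T (suc h) y → ¬ InColsOfLen la T h y → a ≤ y
      a-least y y-in y-new with ∈-∷ʳ⁻ (proj₂ pre∷ʳa≐ (InColsOfLen⇒flag y-in))
      ... | inj₁ y∈pre = contradiction (flag⇒InColsOfLen h<n (proj₁ pre≐ y∈pre)) y-new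
      ... | inj₂ refl = ≤-refl
      mx-in : InColsOfLen la T h (max m pre)
      mx-in = flag⇒InColsOfLen h<n (proj₁ pre≐ (max-∈ m∈pre))
      mx-greatest : ∀ y → InColsOfLen la T h y → y ≤ max m pre
      mx-greatest y y-in = All.lookup (xs≤max m pre) (proj₂ pre≐ (InColsOfLen⇒flag y-in))

    private
      chain : ∃[ π ] Unique π × length π ≡ n × (∀ {h} → h ≤ n → take h π ≐ flag h)
      chain = chain⇒permutation flag n flag-unique flag-length flag-nested

    keyPerm : List ℕ
    keyPerm = proj₁ chain

    private
      keyPerm! : Unique keyPerm
      keyPerm! = proj₁ (proj₂ chain)
      |keyPerm|≡n : length keyPerm ≡ n
      |keyPerm|≡n = proj₁ (proj₂ (proj₂ chain))
      prefix≐flag : h ≤ n → take h keyPerm ≐ flag h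
      prefix≐flag = proj₂ (proj₂ (proj₂ chain))

    keyPerm-isPermutation : IsPermutation n keyPerm
    keyPerm-isPermutation = record
      { unique = keyPerm! ; length≡ = |keyPerm|≡n
      ; ⊆range = λ x∈ → subst (_ ∈_) flag-n
          (proj₁ (prefix≐flag ≤-refl) (subst (_ ∈_) (sym (take-all n keyPerm (≤-reflexive |keyPerm|≡n))) x∈)) }

    private
      next-prefix≐flag : h < n → take h keyPerm ∷ʳ nth keyPerm h ≐ flag (suc h)
      next-prefix≐flag {h} h<n = subst (_≐ flag (suc h)) (take-suc-nth (subst (_ <_) (sym |keyPerm|≡n) h<n)) (prefix≐flag h<n)

      prefix⊆range : take h keyPerm ⊆ range n
      prefix⊆range = ⊆range keyPerm-isPermutation ∘ ∈-take⁻ _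

      nth-positive : h < n → 1 ≤ nth keyPerm h
      nth-positive h<n = proj₁ (∈-range⁻ (⊆range keyPerm-isPermutation (nth-∈ (subst (_ <_) (sym |keyPerm|≡n) h<n))))

    keyPerm-gaplessStep : h < n → GaplessStep (take h keyPerm) (nth keyPerm h)
    keyPerm-gaplessStep {zero} _ ()
    keyPerm-gaplessStep {suc h} h+1<n with suc (suc h) <? n
    ... | yes h+2<n = GaplessStep-flag (s≤s z≤n) h+2<n (prefix≐flag (<⇒≤ h+1<n)) (next-prefix≐flag h+1<n)
                        (nth∉take keyPerm! (subst (_ <_) (sym |keyPerm|≡n) h+1<n))
    ... | no h+2≮n = GaplessStep-last prefix⊆range (nth-positive h+1<n) (proj₂ last-prefix≐range)
      where
      last-prefix≐range : take (suc h) keyPerm ∷ʳ nth keyPerm (suc h) ≐ range n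
      last-prefix≐range = subst (take (suc h) keyPerm ∷ʳ nth keyPerm (suc h) ≐_)
        (trans (cong flag (≤-antisym h+1<n (≮⇒≥ h+2≮n))) flag-n) (next-prefix≐flag h+1<n)

    keyPerm-gapless : GaplessFrom [] keyPerm
    keyPerm-gapless = ValidNext⇒GaplessFrom λ {h} h< →
      let h<n = subst (h <_) |keyPerm|≡n h< in
      nth∉take keyPerm! h< , nth-positive h<n , keyPerm-gaplessStep h<n

    keyOf-keyPerm : T ≡ keyOf keyPerm
    keyOf-keyPerm = tableau-ext tableau (proj₁ (fromColumns-isKey (keyColumns keyPerm-isPermutation)))
      (λ {j} → InColumn-keyOf⁺ keyPerm-isPermutation ∘ proj₂ (prefix≐flag (colLen≤ la j))
                 ∘ proj₁ (column-≐-flag j) ∘ ∈-column⁺ T)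
      (λ {j} → ∈-column⁻ T ∘ proj₂ (column-≐-flag j)
                 ∘ proj₁ (prefix≐flag (colLen≤ la j)) ∘ InColumn-keyOf⁻ keyPerm-isPermutation)

corollary9p3 : (n : ℕ) (la : Vec ℕ n) → StrictPartition la
    → HasCount (IsGaplessKey la) (catalan n)
corollary9p3 n la sp =
  map (keyOf la sp) perms , keys-unique , (λ T → mk⇔ (listed⇒gaplessKey T) (gaplessKey⇒listed T)) , keys-length
  where
  perms : List (List ℕ)
  perms = stackPerms n 0 []
  keys-unique : Unique (map (keyOf la sp) perms)
  keys-unique = Unique-map⁺ (λ p q → keyOf-injective la sp (proj₁ (∈-stackPerms⁻ n p)) (proj₁ (∈-stackPerms⁻ n q)))
                            (stackPerms-unique n 0 [] [])
  listed⇒gaplessKey : ∀ T → T ∈ map (keyOf la sp) perms → IsGaplessKey la T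
  listed⇒gaplessKey T T∈ with ∈-map⁻ (keyOf la sp) T∈
  ... | π , π∈ , refl = keyOf-gaplessKey la sp (proj₁ (∈-stackPerms⁻ n π∈)) (proj₂ (∈-stackPerms⁻ n π∈))
  gaplessKey⇒listed : ∀ T → IsGaplessKey la T → T ∈ map (keyOf la sp) perms
  gaplessKey⇒listed T G = subst (_∈ map (keyOf la sp) perms) (sym (keyOf-keyPerm la sp G))
    (∈-map⁺ (keyOf la sp) (∈-stackPerms⁺ (keyPerm-isPermutation la sp G) (keyPerm-gapless la sp G)))
  keys-length : length (map (keyOf la sp) perms) ≡ catalan n
  keys-length = trans (length-map _ perms) (trans (length-stackPerms n 0 []) (sym (catalan≡ballot n)))
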